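{- Let $F$ be a finite family of finite sets and $w$ a weight function on $\bigcup F$. Let $K,S$ be sets with $K\cup S=\bigcup F$ and $K\cap S=\emptyset$. If for every $K'\subseteq K$ we have $\sum_{A\in H(K',S)\cap F}\bigl(2w(A)-w(\bigcup F)\bigr)\ge 0$, where $H(K',S)=\{A: K'\subseteq A\subseteq K'\cup S\}$, then $F$ satisfies the Frankl condition.
   Context: A function $w:X\to\mathbb{N}$ is a weight function on $A\subseteq X$ if $w(a)>0$ for some $a\in A$; $w(A)=\sum_{a\in A}w(a)$; sums computed in the integers. $F$ satisfies the Frankl condition if some $a\in\bigcup F$ satisfies $2\cdot|\{A\in F: a\in A\}|\ge|F|$. -}

module Defs where

open import Data.Nat using (ℕ; _*_; _≥_; _>_)
open import Data.Integer as ℤ using (ℤ; +_; _-_)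
open import Data.Fin using (Fin)
open import Data.Fin.Subset using (Subset; _∈_; _⊆_; _∪_; ⋃)
open import Data.Fin.Subset.Properties using (_∈?_; _⊆?_)
open import Data.List using (List; filter; map; length; allFin; foldr)
open import Data.Nat.ListAction using (sum)
open import Data.Product using (Σ; _×_)
open import Relation.Nullary.Decidable using (_×-dec_)

private variable n : ℕ

wt : (Fin n → ℕ) → Subset n → ℕ
wt w A = sum (map w (filter (_∈? A) (allFin _)))

IsWeightOn : (Fin n → ℕ) → Subset n → Set
IsWeightOn w U = Σ (Fin _) λ a → a ∈ U × w a > 0

HF : Subset n → Subset n → List (Subset n) → List (Subset n)
HF K′ S F = filter (λ A → (K′ ⊆? A) ×-dec (A ⊆? (K′ ∪ S))) F

zsum : List ℤ → ℤ
zsum = foldr ℤ._+_ (+ 0)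

excess : (Fin n → ℕ) → Subset n → List (Subset n) → ℤ
excess w U L = zsum (map (λ A → + (2 * wt w A) - + (wt w U)) L)

deg : Fin n → List (Subset n) → ℕ
deg a F = length (filter (a ∈?_) F)

Frankl : List (Subset n) → Set
Frankl F = Σ (Fin _) λ a → a ∈ ⋃ F × 2 * deg a F ≥ length F

-- Write U = ⋃F and excess(L) = Σ_{A ∈ L} (2 w(A) − w(U)).  The proof has two
-- independent halves.
--
-- Since K ∪ S = U and K ∩ S = ∅, every member A of F lies in
--     exactly one interval H(K′,S) with K′ ⊆ K, namely the one with
--     K′ = A ∩ K.  So the intervals partition F, and excess(F) is a sum of the
--     interval excesses, each ≥ 0 by hypothesis.
--
-- By double counting, Σ_{A∈F} w(A) = Σ_a w(a)·deg(a), so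
--     excess(F) ≥ 0 says Σ_{a ∈ U} w(a)·(2 deg(a) − |F|) ≥ 0.  If every
--     a ∈ U had 2 deg(a) < |F|, every term would be ≤ 0 and the term of an
--     element of positive weight < 0; hence some a ∈ U satisfies
--     2 deg(a) ≥ |F| ('frankl-of-excess').
module Submission where

open import Defs
open import Data.Nat using (ℕ)
open import Data.Integer using (_≤_; +_)
open import Data.Fin using (Fin)
open import Data.Fin.Subset using (Subset; _⊆_; _∪_; _∩_; ⋃; ⊥)
open import Data.List using (List)
open import Data.List.Relation.Unary.Unique.Propositional using (Unique)
open import Relation.Binary.PropositionalEquality using (_≡_)

open import Data.Nat as ℕ using (zero; suc; _*_; _<_)
import Data.Nat.Properties as ℕP
open import Data.Nat.Tactic.RingSolver using () renaming (solve-∀ to ℕ-solve)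
open import Data.Nat.ListAction using (sum)
open import Data.Integer as ℤ using (ℤ; _-_)
import Data.Integer.Properties as ℤP
open import Data.Integer.Tactic.RingSolver using () renaming (solve-∀ to ℤ-solve)
open import Data.Fin.Properties using (any?)
open import Data.Fin.Subset using (_∈_; _∉_)
open import Data.Fin.Subset.Properties
  using (_∈?_; _⊆?_; p⊆p∪q; q⊆p∪q; x∈p∪q⁻; x∈p∪q⁺; x∈p∩q⁺; p∩q⊆p; p∩q⊆q; ∉⊥; ⊆-antisym)
open import Data.List using ([]; _∷_; filter; map; length; allFin)
open import Data.List.Properties using (filter-reject; filter-none; filter-notAll; map-cong)
open import Data.List.Relation.Unary.All as All using (All; []; _∷_)
open import Data.List.Relation.Unary.All.Properties using (all-filter; filter⁺)
open import Data.List.Relation.Unary.Any using (here; there)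
open import Data.List.Membership.Propositional using () renaming (_∈_ to _∈ₗ_)
open import Data.List.Membership.Propositional.Properties using (∈-allFin)
open import Data.Product using (_×_; _,_)
open import Data.Sum using (inj₁; inj₂)
open import Data.Bool using (if_then_else_)
open import Data.Empty using (⊥-elim)
open import Function using (_∘_)
open import Level using (Level)
open import Relation.Nullary using (Dec; yes; no; ¬_; does)
open import Relation.Nullary.Decidable using (¬?; _×-dec_)
open import Relation.Unary using (Pred; Decidable)
open import Relation.Binary.PropositionalEquality using (refl; sym; trans; cong; cong₂; subst; subst₂; module ≡-Reasoning)

private variable
  a p q : Level
  X B : Set a
  n : ℕ

filter-absorb : {P : Pred X p} {Q : Pred X q} (P? : Decidable P) (Q? : Decidable Q) →
                (∀ {x} → P x → Q x) → ∀ xs → filter P? (filter Q? xs) ≡ filter P? xs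
filter-absorb P? Q? P⇒Q [] = refl
filter-absorb P? Q? P⇒Q (x ∷ xs) with Q? x
... | no ¬Qx = trans (filter-absorb P? Q? P⇒Q xs) (sym (filter-reject P? (¬Qx ∘ P⇒Q)))
... | yes _ with P? x
...   | yes _ = cong (x ∷_) (filter-absorb P? Q? P⇒Q xs)
...   | no _  = filter-absorb P? Q? P⇒Q xs

module Classes (g : X → ℤ) where

  total : List X → ℤ
  total xs = zsum (map g xs)

  total-split : {P : Pred X p} (P? : Decidable P) → ∀ xs →
                total xs ≡ total (filter P? xs) ℤ.+ total (filter (¬? ∘ P?) xs)
  total-split P? [] = refl
  total-split P? (x ∷ xs) with P? x
  ... | yes _ = trans (cong (ℤ._+_ (g x)) (total-split P? xs)) (sym (ℤP.+-assoc (g x) _ _))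
  ... | no _  = trans (cong (ℤ._+_ (g x)) (total-split P? xs))
                      (swap-front (g x) (total (filter P? xs)) (total (filter (¬? ∘ P?) xs)))
    where
    swap-front : ∀ (i j k : ℤ) → i ℤ.+ (j ℤ.+ k) ≡ j ℤ.+ (i ℤ.+ k)
    swap-front = ℤ-solve

  -- Classes H c indexed by c : B; κ x is the class of x, and a member x of
  -- the class of y has the same class as y (the classes κ y are disjoint).
  nonneg-by-classes : (H : B → Pred X p) (H? : ∀ c → Decidable (H c)) (κ : X → B) →
    (∀ {x y} → H (κ y) x → κ x ≡ κ y) →
    ∀ L → All (λ x → H (κ x) x) L →
    All (λ x → + 0 ≤ total (filter (H? (κ x)) L)) L → + 0 ≤ total L
  nonneg-by-classes H H? κ exclusive L = peel (length L) L ℕP.≤-refl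
    where
    -- Remove the class of the first element and recurse on the (shorter) rest.
    peel : ∀ m L → length L ℕ.≤ m → All (λ x → H (κ x) x) L →
           All (λ x → + 0 ≤ total (filter (H? (κ x)) L)) L → + 0 ≤ total L
    peel _ [] _ _ _ = ℤP.≤-refl
    peel zero (_ ∷ _) () _ _
    peel (suc m) L@(x ∷ _) len cover@(Hx ∷ _) classes@(nonneg-x ∷ _) =
      subst (+ 0 ≤_) (sym (total-split (H? (κ x)) L))
            (ℤP.+-mono-≤ nonneg-x (peel m rest shorter (filter⁺ outside? cover) classes-rest))
      where
      outside? = ¬? ∘ H? (κ x)
      rest = filter outside? L
      shorter : length rest ℕ.≤ m
      shorter = ℕP.≤-pred (ℕP.<-≤-trans (filter-notAll outside? L (here (λ ¬Hx → ¬Hx Hx))) len)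
      same-class : ∀ {y} → ¬ H (κ x) y → H (κ y) y →
                   filter (H? (κ y)) rest ≡ filter (H? (κ y)) L
      same-class {y} ¬Hxy Hy = filter-absorb (H? (κ y)) outside?
        (λ {z} Hyz Hxz → ¬Hxy (subst (λ c → H c _) (trans (sym (exclusive Hyz)) (exclusive Hxz)) Hy)) L
      classes-rest : All (λ y → + 0 ≤ total (filter (H? (κ y)) rest)) rest
      classes-rest = All.map
        (λ { (¬Hxy , Hy , nonneg) → subst (λ ys → + 0 ≤ total ys) (sym (same-class ¬Hxy Hy)) nonneg })
                       (All.zip (all-filter outside? L , filter⁺ outside? (All.zip (cover , classes))))

module Intervals {K S : Subset n} (disjoint : K ∩ S ≡ ⊥) where

  InH : Subset n → Subset n → Set
  InH K′ A = K′ ⊆ A × A ⊆ K′ ∪ S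

  inH⇒trace : ∀ {K′ A} → K′ ⊆ K → InH K′ A → A ∩ K ≡ K′
  inH⇒trace {K′} {A} K′⊆K (K′⊆A , A⊆K′∪S) = ⊆-antisym trace⊆K′ (λ x∈K′ → x∈p∩q⁺ (K′⊆A x∈K′ , K′⊆K x∈K′))
    where
    trace⊆K′ : A ∩ K ⊆ K′
    trace⊆K′ {x} x∈A∩K with x∈p∪q⁻ K′ S (A⊆K′∪S (p∩q⊆p A K x∈A∩K))
    ... | inj₁ x∈K′ = x∈K′
    ... | inj₂ x∈S  = ⊥-elim (∉⊥ (subst (x ∈_) disjoint (x∈p∩q⁺ (p∩q⊆q A K x∈A∩K , x∈S))))

  trace⇒inH : ∀ {A} → A ⊆ K ∪ S → InH (A ∩ K) A
  trace⇒inH {A} A⊆K∪S = p∩q⊆p A K , split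
    where
    split : A ⊆ (A ∩ K) ∪ S
    split {x} x∈A with x∈p∪q⁻ K S (A⊆K∪S x∈A)
    ... | inj₁ x∈K = x∈p∪q⁺ (inj₁ (x∈p∩q⁺ (x∈A , x∈K)))
    ... | inj₂ x∈S = x∈p∪q⁺ (inj₂ x∈S)

  excess-nonneg : (w : Fin n → ℕ) (U : Subset n) (F : List (Subset n)) →
    All (_⊆ K ∪ S) F →
    ((K′ : Subset n) → K′ ⊆ K → + 0 ≤ excess w U (HF K′ S F)) →
    + 0 ≤ excess w U F
  excess-nonneg w U F F⊆K∪S hyp =
    Classes.nonneg-by-classes (λ A → + (2 * wt w A) - + (wt w U))
      InH (λ K′ A → (K′ ⊆? A) ×-dec (A ⊆? (K′ ∪ S))) (_∩ K)
      (λ {_} {A} → inH⇒trace (p∩q⊆q A K)) F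
      (All.map trace⇒inH F⊆K∪S)
      (All.map (λ {A} _ → hyp (A ∩ K) (p∩q⊆q A K)) F⊆K∪S)

∑ : (X → ℕ) → List X → ℕ
∑ f xs = sum (map f xs)

[_]·_ : {P : Set p} → Dec P → ℕ → ℕ
[ d ]· v = if does d then v else 0

∑-const : ∀ v (xs : List X) → ∑ (λ _ → v) xs ≡ v * length xs
∑-const v []       = sym (ℕP.*-zeroʳ v)
∑-const v (_ ∷ xs) = trans (cong (v ℕ.+_) (∑-const v xs)) (sym (ℕP.*-suc v (length xs)))

∑-filter : {P : Pred X p} (P? : Decidable P) (f : X → ℕ) →
           ∀ xs → ∑ f (filter P? xs) ≡ ∑ (λ x → [ P? x ]· f x) xs
∑-filter P? f [] = refl
∑-filter P? f (x ∷ xs) with P? x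
... | yes _ = cong (f x ℕ.+_) (∑-filter P? f xs)
... | no _  = ∑-filter P? f xs

∑-+ : (f h : X → ℕ) → ∀ xs → ∑ (λ x → f x ℕ.+ h x) xs ≡ ∑ f xs ℕ.+ ∑ h xs
∑-+ f h [] = refl
∑-+ f h (x ∷ xs) = trans (cong (f x ℕ.+ h x ℕ.+_) (∑-+ f h xs))
                        (interchange (f x) (h x) (∑ f xs) (∑ h xs))
  where
  interchange : ∀ i j k l → i ℕ.+ j ℕ.+ (k ℕ.+ l) ≡ i ℕ.+ k ℕ.+ (j ℕ.+ l)
  interchange = ℕ-solve

∑-*ˡ : ∀ k (f : X → ℕ) xs → k * ∑ f xs ≡ ∑ (λ x → k * f x) xs
∑-*ˡ k f [] = ℕP.*-zeroʳ k
∑-*ˡ k f (x ∷ xs) = trans (ℕP.*-distribˡ-+ k (f x) (∑ f xs)) (cong (k * f x ℕ.+_) (∑-*ˡ k f xs))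

∑-swap : (G : X → B → ℕ) (L : List X) (ys : List B) →
         ∑ (λ x → ∑ (G x) ys) L ≡ ∑ (λ y → ∑ (λ x → G x y) L) ys
∑-swap G [] ys = sym (trans (∑-const 0 ys) (ℕP.*-zeroˡ (length ys)))
∑-swap G (x ∷ L) ys = trans (cong (∑ (G x) ys ℕ.+_) (∑-swap G L ys))
                            (sym (∑-+ (G x) (λ y → ∑ (λ x → G x y) L) ys))

∑-mono : {f h : X → ℕ} → (∀ x → f x ℕ.≤ h x) → ∀ xs → ∑ f xs ℕ.≤ ∑ h xs
∑-mono f≤h [] = ℕ.z≤n
∑-mono f≤h (x ∷ xs) = ℕP.+-mono-≤ (f≤h x) (∑-mono f≤h xs)

∑-mono-< : {f h : X → ℕ} → (∀ x → f x ℕ.≤ h x) → ∀ {x₀ xs} → x₀ ∈ₗ xs → f x₀ < h x₀ → ∑ f xs < ∑ h xs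
∑-mono-< f≤h {xs = x ∷ xs} (here refl) lt = ℕP.+-mono-<-≤ lt (∑-mono f≤h xs)
∑-mono-< f≤h {xs = x ∷ xs} (there x₀∈xs) lt = ℕP.+-mono-≤-< (f≤h x) (∑-mono-< f≤h x₀∈xs lt)

double-counting : (w : Fin n → ℕ) (L : List (Subset n)) →
                  ∑ (wt w) L ≡ ∑ (λ a → w a * deg a L) (allFin n)
double-counting {n} w L = begin
  ∑ (wt w) L                                                   ≡⟨ cong sum (map-cong (λ A → ∑-filter (_∈? A) w (allFin n)) L) ⟩
  ∑ (λ A → ∑ (λ a → [ a ∈? A ]· w a) (allFin n)) L             ≡⟨ ∑-swap (λ A a → [ a ∈? A ]· w a) L (allFin n) ⟩
  ∑ (λ a → ∑ (λ A → [ a ∈? A ]· w a) L) (allFin n)             ≡⟨ cong sum (map-cong occurrences (allFin n)) ⟩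
  ∑ (λ a → w a * deg a L) (allFin n)                           ∎
  where
  open ≡-Reasoning
  occurrences : ∀ a → ∑ (λ A → [ a ∈? A ]· w a) L ≡ w a * deg a L
  occurrences a = trans (sym (∑-filter (a ∈?_) (λ _ → w a) L)) (∑-const (w a) (filter (a ∈?_) L))

excess-closed : (w : Fin n → ℕ) (U : Subset n) (L : List (Subset n)) →
                excess w U L ≡ + (2 * ∑ (wt w) L) - + (length L * wt w U)
excess-closed w U [] = refl
excess-closed w U (A ∷ L) = begin
  (+ (2 * wt w A) - + u) ℤ.+ excess w U L
    ≡⟨ cong (ℤ._+_ (+ (2 * wt w A) - + u)) (excess-closed w U L) ⟩
  (+ (2 * wt w A) - + u) ℤ.+ (+ (2 * ∑ (wt w) L) - + (length L * u))
    ≡⟨ regroup (+ (2 * wt w A)) (+ u) (+ (2 * ∑ (wt w) L)) (+ (length L * u)) ⟩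
  (+ (2 * wt w A) ℤ.+ + (2 * ∑ (wt w) L)) - (+ u ℤ.+ + (length L * u))
    ≡⟨ cong₂ _-_ (sym (ℤP.pos-+ (2 * wt w A) (2 * ∑ (wt w) L))) (sym (ℤP.pos-+ u (length L * u))) ⟩
  + (2 * wt w A ℕ.+ 2 * ∑ (wt w) L) - + (u ℕ.+ length L * u)
    ≡⟨ cong (λ t → + t - + (u ℕ.+ length L * u)) (sym (ℕP.*-distribˡ-+ 2 (wt w A) (∑ (wt w) L))) ⟩
  + (2 * ∑ (wt w) (A ∷ L)) - + (length (A ∷ L) * u) ∎
  where
  open ≡-Reasoning
  u = wt w U
  regroup : ∀ i j k l → (i - j) ℤ.+ (k - l) ≡ (i ℤ.+ k) - (j ℤ.+ l)
  regroup = ℤ-solve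

⋃-upper : (F : List (Subset n)) → All (_⊆ ⋃ F) F
⋃-upper []      = []
⋃-upper (A ∷ F) = p⊆p∪q (⋃ F) ∷ All.map (λ A′⊆⋃F {x} x∈A′ → q⊆p∪q A (⋃ F) (A′⊆⋃F x∈A′)) (⋃-upper F)

deg-outside : ∀ {a} (F : List (Subset n)) → a ∉ ⋃ F → deg a F ≡ 0
deg-outside F a∉⋃F = cong length (filter-none (_ ∈?_) (All.map (λ A⊆⋃F a∈A → a∉⋃F (A⊆⋃F a∈A)) (⋃-upper F)))

scale-reorder : ∀ v d → 2 * d * v ≡ 2 * (v * d)
scale-reorder = ℕ-solve

scale-≤ : ∀ v {d l} → 2 * d ℕ.≤ l → 2 * (v * d) ℕ.≤ l * v
scale-≤ v {d} {l} le = subst (ℕ._≤ l * v) (scale-reorder v d) (ℕP.*-monoˡ-≤ v le)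

scale-< : ∀ v {d l} → 0 < v → 2 * d < l → 2 * (v * d) < l * v
scale-< v@(suc _) {d} {l} _ lt = subst (_< l * v) (scale-reorder v d) (ℕP.*-monoˡ-< v lt)

frankl-of-excess : (F : List (Subset n)) (w : Fin n → ℕ) → IsWeightOn w (⋃ F) →
                   + 0 ≤ excess w (⋃ F) F → Frankl F
frankl-of-excess {n} F w (a₀ , a₀∈U , w₀>0) nonneg
  with any? (λ a → (a ∈? ⋃ F) ×-dec (2 * deg a F ℕP.≥? length F))
... | yes frequent = frequent
... | no none = ⊥-elim (ℕP.<⇒≱ light heavy)
  where
  U = ⋃ F

  rare : ∀ {a} → a ∈ U → 2 * deg a F < length F
  rare a∈U = ℕP.≰⇒> (λ frequent → none (_ , a∈U , frequent))

  termwise : ∀ a → 2 * (w a * deg a F) ℕ.≤ length F * [ a ∈? U ]· w a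
  termwise a with a ∈? U
  ... | yes a∈U = scale-≤ (w a) (ℕP.<⇒≤ (rare a∈U))
  ... | no a∉U rewrite deg-outside F a∉U | ℕP.*-zeroʳ (w a) = ℕ.z≤n

  strict : 2 * (w a₀ * deg a₀ F) < length F * [ a₀ ∈? U ]· w a₀
  strict with a₀ ∈? U
  ... | yes a₀∈U = scale-< (w a₀) w₀>0 (rare a₀∈U)
  ... | no a₀∉U = ⊥-elim (a₀∉U a₀∈U)

  light : 2 * ∑ (wt w) F < length F * wt w U
  light = subst₂ _<_
    (sym (trans (cong (2 *_) (double-counting w F)) (∑-*ˡ 2 (λ a → w a * deg a F) (allFin n))))
    (sym (trans (cong (length F *_) (∑-filter (_∈? U) w (allFin n))) (∑-*ˡ (length F) _ (allFin n))))
    (∑-mono-< termwise (∈-allFin a₀) strict)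

  heavy : length F * wt w U ℕ.≤ 2 * ∑ (wt w) F
  heavy = ℤP.drop‿+≤+ (ℤP.0≤i-j⇒j≤i (subst (+ 0 ≤_) (excess-closed w U F) nonneg))

lemma3 : (n : ℕ) (F : List (Subset n)) → Unique F →
    (w : Fin n → ℕ) → IsWeightOn w (⋃ F) →
    (K S : Subset n) → K ∪ S ≡ ⋃ F → K ∩ S ≡ ⊥ →
    ((K′ : Subset n) → K′ ⊆ K → + 0 ≤ excess w (⋃ F) (HF K′ S F)) →
    Frankl F
lemma3 n F _ w weighted K S K∪S≡⋃F disjoint intervals-nonneg =
  frankl-of-excess F w weighted
    (Intervals.excess-nonneg {K = K} {S = S} disjoint w (⋃ F) F members⊆K∪S intervals-nonneg)
  where
  members⊆K∪S : All (_⊆ K ∪ S) F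
  members⊆K∪S = subst (λ U → All (_⊆ U) F) (sym K∪S≡⋃F) (⋃-upper F)
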